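{- Let $h:\mathbb{Z}_{\ge0}\to\mathbb{Z}_{\ge0}$ be nondecreasing and satisfy: for all $z,z'\in\mathbb{Z}_{\ge0}$ and every positive integer $i$, if $\lfloor z/2^i\rfloor=\lfloor z'/2^i\rfloor$ then $\lfloor h(z)/2^{i-1}\rfloor=\lfloor h(z')/2^{i-1}\rfloor$. Let $x,y,z\in\mathbb{Z}_{\ge0}$ with $x\oplus y\oplus z=0$ and $y\le h(z)$. Then: (i) $u\oplus y\oplus z\neq0$ for every $u\in\mathbb{Z}_{\ge0}$ with $u<x$; (ii) $x\oplus v\oplus z\neq0$ for every $v\in\mathbb{Z}_{\ge0}$ with $v<y$; (iii) $x\oplus y\oplus w\neq0$ for every $w\in\mathbb{Z}_{\ge0}$ with $w<z$; (iv) $x\oplus v\oplus w\neq0$ for all $v,w\in\mathbb{Z}_{\ge0}$ with $v<y$, $w<z$ and $v=h(w)$.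
   Context: $\oplus$ denotes nim-sum (bitwise XOR of binary expansions). -}

module Defs where

open import Data.Nat using (ℕ; zero; suc; _+_; _*_; _^_; _≤_)
open import Data.Nat.DivMod using (_/_; _%_)
open import Data.Nat.Properties using (m^n≢0)
open import Data.Bool using (Bool; true; false; _xor_)
open import Relation.Binary.PropositionalEquality using (_≡_)

bit0 : ℕ → Bool
bit0 n with n % 2
... | zero = false
... | suc _ = true

fromBit : Bool → ℕ
fromBit true  = 1
fromBit false = 0

-- bitwise XOR, with a fuel argument; fuel ≥ a + b is always enough,
-- since each step halves both arguments
xorFuel : ℕ → ℕ → ℕ → ℕ
xorFuel zero    a b = 0
xorFuel (suc k) a b = fromBit (bit0 a xor bit0 b) + 2 * xorFuel k (a / 2) (b / 2)

infixl 6 _⊕_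
_⊕_ : ℕ → ℕ → ℕ
a ⊕ b = xorFuel (a + b) a b

infixl 7 _/2^_
_/2^_ : ℕ → ℕ → ℕ
z /2^ i = _/_ z (2 ^ i) {{m^n≢0 2 i}}

Monotone : (ℕ → ℕ) → Set
Monotone h = ∀ {a b} → a ≤ b → h a ≤ h b

-- for every positive integer i (written suc j, so i - 1 = j):
-- ⌊z/2^i⌋ = ⌊z'/2^i⌋ implies ⌊h z/2^(i-1)⌋ = ⌊h z'/2^(i-1)⌋
ShiftCompatible : (ℕ → ℕ) → Set
ShiftCompatible h = ∀ z z' j → z /2^ suc j ≡ z' /2^ suc j → h z /2^ j ≡ h z' /2^ j

-- Parts (i)–(iii) are cancellation for ⊕. For (iv), let i be the highest binary position
-- at which w < z differ, so ⌊z/2^(i+1)⌋ = ⌊w/2^(i+1)⌋ but ⌊z/2^i⌋ ≠ ⌊w/2^i⌋. The hypothesis on h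
-- gives ⌊h z/2^i⌋ = ⌊h w/2^i⌋ = ⌊v/2^i⌋, and v < y ≤ h z squeezes ⌊y/2^i⌋ to that same value.
-- Since ⌊·/2^i⌋ commutes with ⊕, the equations z = x ⊕ y and w = x ⊕ v then force
-- ⌊z/2^i⌋ = ⌊w/2^i⌋, a contradiction.
module Submission where

open import Defs
open import Data.Nat using (ℕ; zero; suc; _+_; _*_; _^_; _≤_; _<_; z≤n; s≤s; s≤s⁻¹; _≟_)
open import Data.Nat.Properties
open import Data.Nat.DivMod
open import Data.Nat.Divisibility using (divides-refl)
open import Data.Bool using (true; false; _xor_)
open import Data.Bool.Properties using (xor-comm; xor-same)
open import Data.Product using (_×_; _,_; ∃)
open import Data.Empty using (⊥-elim)
open import Relation.Nullary using (yes; no)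
open import Relation.Binary.PropositionalEquality

%2≡fromBit-bit0 : ∀ n → n % 2 ≡ fromBit (bit0 n)
%2≡fromBit-bit0 n with n % 2 | m%n<n n 2
... | zero        | _ = refl
... | suc zero    | _ = refl
... | suc (suc _) | s≤s (s≤s ())

fromBit-bit0+2*[n/2]≡n : ∀ n → fromBit (bit0 n) + 2 * (n / 2) ≡ n
fromBit-bit0+2*[n/2]≡n n =
  sym (trans (m≡m%n+[m/n]*n n 2) (cong₂ _+_ (%2≡fromBit-bit0 n) (*-comm (n / 2) 2)))

fromBit<2 : ∀ b → fromBit b < 2
fromBit<2 true  = s≤s (s≤s z≤n)
fromBit<2 false = s≤s z≤n

[fromBit+2*m]%2≡fromBit : ∀ b m → (fromBit b + 2 * m) % 2 ≡ fromBit b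
[fromBit+2*m]%2≡fromBit b m = begin
  (fromBit b + 2 * m) % 2 ≡⟨ cong (λ k → (fromBit b + k) % 2) (*-comm 2 m) ⟩
  (fromBit b + m * 2) % 2 ≡⟨ [m+kn]%n≡m%n (fromBit b) m 2 ⟩
  fromBit b % 2           ≡⟨ m<n⇒m%n≡m (fromBit<2 b) ⟩
  fromBit b               ∎
  where open ≡-Reasoning

[fromBit+2*m]/2≡m : ∀ b m → (fromBit b + 2 * m) / 2 ≡ m
[fromBit+2*m]/2≡m b m = begin
  (fromBit b + 2 * m) / 2     ≡⟨ cong (λ k → (fromBit b + k) / 2) (*-comm 2 m) ⟩
  (fromBit b + m * 2) / 2     ≡⟨ +-distrib-/-∣ʳ (fromBit b) (divides-refl m) ⟩
  fromBit b / 2 + m * 2 / 2   ≡⟨ cong₂ _+_ (m<n⇒m/n≡0 (fromBit<2 b)) (m*n/n≡m m 2) ⟩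
  m                           ∎
  where open ≡-Reasoning

fromBit-injective : ∀ {b c} → fromBit b ≡ fromBit c → b ≡ c
fromBit-injective {true}  {true}  _ = refl
fromBit-injective {false} {false} _ = refl

fromBit+2*-injective : ∀ {b c} {m n} → fromBit b + 2 * m ≡ fromBit c + 2 * n → b ≡ c × m ≡ n
fromBit+2*-injective {b} {c} {m} {n} eq =
  fromBit-injective (trans (sym ([fromBit+2*m]%2≡fromBit b m))
                           (trans (cong (_% 2) eq) ([fromBit+2*m]%2≡fromBit c n))) ,
  trans (sym ([fromBit+2*m]/2≡m b m)) (trans (cong (_/ 2) eq) ([fromBit+2*m]/2≡m c n))

m≤1+n⇒m/2≤n : ∀ {m n} → m ≤ suc n → m / 2 ≤ n
m≤1+n⇒m/2≤n {zero}  _   = z≤n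
m≤1+n⇒m/2≤n {suc m} m≤n = s≤s⁻¹ (≤-trans (m/n<m (suc m) 2 (s≤s (s≤s z≤n))) m≤n)

xor-cancelˡ : ∀ a {b c} → a xor b ≡ a xor c → b ≡ c
xor-cancelˡ false eq = eq
xor-cancelˡ true {true}  {true}  _ = refl
xor-cancelˡ true {false} {false} _ = refl

xorFuel-zero : ∀ k → xorFuel k 0 0 ≡ 0
xorFuel-zero zero    = refl
xorFuel-zero (suc k) = cong (2 *_) (xorFuel-zero k)

xorFuel-fuel-irrelevant : ∀ k k' {a b} → a ≤ k → b ≤ k → a ≤ k' → b ≤ k' →
  xorFuel k a b ≡ xorFuel k' a b
xorFuel-fuel-irrelevant zero    k'      z≤n z≤n _   _   = sym (xorFuel-zero k')
xorFuel-fuel-irrelevant (suc k) zero    _   _   z≤n z≤n = xorFuel-zero (suc k)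
xorFuel-fuel-irrelevant (suc k) (suc k') {a} {b} a≤k b≤k a≤k' b≤k' =
  cong (λ t → fromBit (bit0 a xor bit0 b) + 2 * t)
    (xorFuel-fuel-irrelevant k k' (m≤1+n⇒m/2≤n a≤k) (m≤1+n⇒m/2≤n b≤k)
                                  (m≤1+n⇒m/2≤n a≤k') (m≤1+n⇒m/2≤n b≤k'))

xorFuel-unfold : ∀ k a b → a + b ≡ k →
  xorFuel k a b ≡ fromBit (bit0 a xor bit0 b) + 2 * (a / 2 ⊕ b / 2)
xorFuel-unfold zero    a b a+b≡0
  rewrite m+n≡0⇒m≡0 a a+b≡0 | m+n≡0⇒n≡0 a a+b≡0 = refl
xorFuel-unfold (suc k) a b a+b≡1+k =
  cong (λ t → fromBit (bit0 a xor bit0 b) + 2 * t)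
    (xorFuel-fuel-irrelevant k (a / 2 + b / 2)
      (m≤1+n⇒m/2≤n (≤-trans (m≤m+n a b) (≤-reflexive a+b≡1+k)))
      (m≤1+n⇒m/2≤n (≤-trans (m≤n+m b a) (≤-reflexive a+b≡1+k)))
      (m≤m+n _ _) (m≤n+m _ _))

⊕-unfold : ∀ a b → a ⊕ b ≡ fromBit (bit0 a xor bit0 b) + 2 * (a / 2 ⊕ b / 2)
⊕-unfold a b = xorFuel-unfold (a + b) a b refl

bit0-/2-injective : ∀ {m n} → bit0 m ≡ bit0 n → m / 2 ≡ n / 2 → m ≡ n
bit0-/2-injective {m} {n} bits halves = begin
  m                               ≡⟨ fromBit-bit0+2*[n/2]≡n m ⟨
  fromBit (bit0 m) + 2 * (m / 2)  ≡⟨ cong₂ (λ β t → fromBit β + 2 * t) bits halves ⟩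
  fromBit (bit0 n) + 2 * (n / 2)  ≡⟨ fromBit-bit0+2*[n/2]≡n n ⟩
  n                               ∎
  where open ≡-Reasoning

⊕-cancelˡ-≤ : ∀ k a {b c} → b ≤ k → c ≤ k → a ⊕ b ≡ a ⊕ c → b ≡ c
⊕-cancelˡ-≤ zero    a z≤n z≤n _ = refl
⊕-cancelˡ-≤ (suc k) a {b} {c} b≤1+k c≤1+k eq
  with fromBit+2*-injective (trans (sym (⊕-unfold a b)) (trans eq (⊕-unfold a c)))
... | bits , halves = bit0-/2-injective (xor-cancelˡ (bit0 a) bits)
  (⊕-cancelˡ-≤ k (a / 2) (m≤1+n⇒m/2≤n b≤1+k) (m≤1+n⇒m/2≤n c≤1+k) halves)

⊕-cancelˡ : ∀ a {b c} → a ⊕ b ≡ a ⊕ c → b ≡ c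
⊕-cancelˡ a {b} {c} = ⊕-cancelˡ-≤ (b + c) a (m≤m+n b c) (m≤n+m c b)

xorFuel-comm : ∀ k a b → xorFuel k a b ≡ xorFuel k b a
xorFuel-comm zero    a b = refl
xorFuel-comm (suc k) a b =
  cong₂ (λ β t → fromBit β + 2 * t) (xor-comm (bit0 a) (bit0 b)) (xorFuel-comm k (a / 2) (b / 2))

⊕-comm : ∀ a b → a ⊕ b ≡ b ⊕ a
⊕-comm a b = trans (xorFuel-comm (a + b) a b) (cong (λ k → xorFuel k b a) (+-comm a b))

⊕-cancelʳ : ∀ {a b} c → a ⊕ c ≡ b ⊕ c → a ≡ b
⊕-cancelʳ {a} {b} c eq = ⊕-cancelˡ c (trans (⊕-comm c a) (trans eq (⊕-comm b c)))

xorFuel-self : ∀ k a → xorFuel k a a ≡ 0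
xorFuel-self zero    a = refl
xorFuel-self (suc k) a = cong₂ (λ β t → fromBit β + 2 * t) (xor-same (bit0 a)) (xorFuel-self k (a / 2))

⊕-self : ∀ a → a ⊕ a ≡ 0
⊕-self a = xorFuel-self (a + a) a

⊕≡0⇒≡ : ∀ {a b} → a ⊕ b ≡ 0 → a ≡ b
⊕≡0⇒≡ {a} eq = sym (⊕-cancelˡ a (trans eq (sym (⊕-self a))))

⊕-/2 : ∀ a b → (a ⊕ b) / 2 ≡ a / 2 ⊕ b / 2
⊕-/2 a b = trans (cong (_/ 2) (⊕-unfold a b)) ([fromBit+2*m]/2≡m (bit0 a xor bit0 b) (a / 2 ⊕ b / 2))

n/2/2^k≡n/2^[1+k] : ∀ n k → n / 2 /2^ k ≡ n /2^ suc k
n/2/2^k≡n/2^[1+k] n k = m/n/o≡m/[n*o] n 2 (2 ^ k) {{_}} {{m^n≢0 2 k}} {{m^n≢0 2 (suc k)}}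

⊕-/2^ : ∀ k a b → (a ⊕ b) /2^ k ≡ a /2^ k ⊕ b /2^ k
⊕-/2^ zero    a b = trans (n/1≡n (a ⊕ b)) (sym (cong₂ _⊕_ (n/1≡n a) (n/1≡n b)))
⊕-/2^ (suc k) a b = begin
  (a ⊕ b) /2^ suc k              ≡⟨ n/2/2^k≡n/2^[1+k] (a ⊕ b) k ⟨
  (a ⊕ b) / 2 /2^ k              ≡⟨ cong (_/2^ k) (⊕-/2 a b) ⟩
  (a / 2 ⊕ b / 2) /2^ k          ≡⟨ ⊕-/2^ k (a / 2) (b / 2) ⟩
  a / 2 /2^ k ⊕ b / 2 /2^ k      ≡⟨ cong₂ _⊕_ (n/2/2^k≡n/2^[1+k] a k) (n/2/2^k≡n/2^[1+k] b k) ⟩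
  a /2^ suc k ⊕ b /2^ suc k      ∎
  where open ≡-Reasoning

⊕-/2^-congʳ : ∀ k a {b c} → b /2^ k ≡ c /2^ k → (a ⊕ b) /2^ k ≡ (a ⊕ c) /2^ k
⊕-/2^-congʳ k a {b} {c} eq = begin
  (a ⊕ b) /2^ k        ≡⟨ ⊕-/2^ k a b ⟩
  a /2^ k ⊕ b /2^ k    ≡⟨ cong (a /2^ k ⊕_) eq ⟩
  a /2^ k ⊕ c /2^ k    ≡⟨ ⊕-/2^ k a c ⟨
  (a ⊕ c) /2^ k        ∎
  where open ≡-Reasoning

/2^-squeeze : ∀ k {a b c} → a ≤ b → b ≤ c → c /2^ k ≡ a /2^ k → b /2^ k ≡ a /2^ k
/2^-squeeze k a≤b b≤c c≡a = ≤-antisym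
  (≤-trans (/-monoˡ-≤ (2 ^ k) {{m^n≢0 2 k}} b≤c) (≤-reflexive c≡a))
  (/-monoˡ-≤ (2 ^ k) {{m^n≢0 2 k}} a≤b)

n<2^n : ∀ n → n < 2 ^ n
n<2^n zero    = s≤s z≤n
n<2^n (suc n) = begin-strict
  suc n          ≡⟨ +-comm 1 n ⟩
  n + 1          <⟨ +-mono-<-≤ (n<2^n n) (m^n>0 2 n) ⟩
  2 ^ n + 2 ^ n  ≡⟨ cong (2 ^ n +_) (+-identityʳ (2 ^ n)) ⟨
  2 ^ suc n      ∎
  where open ≤-Reasoning

m<2^n⇒m/2^n≡0 : ∀ {m} n → m < 2 ^ n → m /2^ n ≡ 0
m<2^n⇒m/2^n≡0 n = m<n⇒m/n≡0 {{m^n≢0 2 n}}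

highest-differing-bit : ∀ k {m n} → m /2^ k ≡ n /2^ k → m ≢ n →
  ∃ λ i → m /2^ suc i ≡ n /2^ suc i × m /2^ i ≢ n /2^ i
highest-differing-bit zero    {m} {n} eq m≢n = ⊥-elim (m≢n (trans (sym (n/1≡n m)) (trans eq (n/1≡n n))))
highest-differing-bit (suc k) {m} {n} eq m≢n with m /2^ k ≟ n /2^ k
... | yes eq′ = highest-differing-bit k eq′ m≢n
... | no  neq = k , eq , neq

mainTheorem11 : (h : ℕ → ℕ) → Monotone h → ShiftCompatible h →
    (x y z : ℕ) → x ⊕ y ⊕ z ≡ 0 → y ≤ h z →
      (∀ u → u < x → u ⊕ y ⊕ z ≢ 0)
      × (∀ v → v < y → x ⊕ v ⊕ z ≢ 0)
      × (∀ w → w < z → x ⊕ y ⊕ w ≢ 0)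
      × (∀ v w → v < y → w < z → v ≡ h w → x ⊕ v ⊕ w ≢ 0)
mainTheorem11 h _ shift x y z x⊕y⊕z≡0 y≤hz = lower-x , lower-y , lower-z , lower-y-z
  where
  x⊕y≡z : x ⊕ y ≡ z
  x⊕y≡z = ⊕≡0⇒≡ x⊕y⊕z≡0

  lower-x : ∀ u → u < x → u ⊕ y ⊕ z ≢ 0
  lower-x u u<x eq = <-irrefl (⊕-cancelʳ y (trans (⊕≡0⇒≡ eq) (sym x⊕y≡z))) u<x

  lower-y : ∀ v → v < y → x ⊕ v ⊕ z ≢ 0
  lower-y v v<y eq = <-irrefl (⊕-cancelˡ x (trans (⊕≡0⇒≡ eq) (sym x⊕y≡z))) v<y

  lower-z : ∀ w → w < z → x ⊕ y ⊕ w ≢ 0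
  lower-z w w<z eq = <-irrefl (trans (sym (⊕≡0⇒≡ eq)) x⊕y≡z) w<z

  lower-y-z : ∀ v w → v < y → w < z → v ≡ h w → x ⊕ v ⊕ w ≢ 0
  lower-y-z v w v<y w<z v≡hw eq
    with highest-differing-bit z
           (trans (m<2^n⇒m/2^n≡0 z (n<2^n z)) (sym (m<2^n⇒m/2^n≡0 z (<-trans w<z (n<2^n z)))))
           (λ z≡w → <-irrefl (sym z≡w) w<z)
  ... | i , agree , differ = differ (begin
    z /2^ i          ≡⟨ cong (_/2^ i) x⊕y≡z ⟨
    (x ⊕ y) /2^ i    ≡⟨ ⊕-/2^-congʳ i x y/2^i≡v/2^i ⟩
    (x ⊕ v) /2^ i    ≡⟨ cong (_/2^ i) (⊕≡0⇒≡ eq) ⟩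
    w /2^ i          ∎)
    where
    open ≡-Reasoning
    y/2^i≡v/2^i : y /2^ i ≡ v /2^ i
    y/2^i≡v/2^i = /2^-squeeze i (<⇒≤ v<y) y≤hz (trans (shift z w i agree) (cong (_/2^ i) (sym v≡hw)))
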